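{- Let $p$ be a prime and let $C=\mathrm{circ}(0,1,0,\dots,0)$ be the basic $p\times p$ circulant permutation matrix. Then: (i) the block matrix $N=[C^{ij}]_{i,j=1,\dots,p-1}$ (the $(i,j)$ block being $C^{ij}=(C^i)^j$) is the incidence matrix of an STD$(p)$, resolvable, semi-regular self-dual rectangular design with parameters $v=b=p^2-p$, $r=k=p-1$, $\lambda_1=\lambda_2=0$, $\lambda_3=1$, $m=p-1$, $n=p$; (ii) the block matrix $N=[I_p+C^{ij}]_{i,j=1,\dots,p-1}$ is the incidence matrix of a $2$-resolvable, semi-regular, STD$(p)$ self-dual rectangular design with parameters $v=b=p^2-p$, $r=k=2(p-1)$, $\lambda_1=2$, $\lambda_2=p-1$, $\lambda_3=3$, $m=p-1$, $n=p$. In both cases the treatments (rows) in the $i$-th block row form the $i$-th row of the $m\times n$ array.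
   Context: A rectangular design (RD) with parameters $v=mn,b,r,k,\lambda_1,\lambda_2,\lambda_3,m,n$ has its treatments arranged in an $m\times n$ array, $b$ blocks of size $k$, replication $r$, and any two distinct treatments occur together in $\lambda_1$ blocks if in the same row, $\lambda_2$ if in the same column, $\lambda_3$ otherwise; its incidence matrix is the $v\times b$ treatment-by-block $(0,1)$-matrix. It is self-dual if the design with transposed incidence matrix is an RD with the same parameters. With $\theta_1=r-\lambda_1+(m-1)(\lambda_2-\lambda_3)$, $\theta_2=r-\lambda_2+(n-1)(\lambda_1-\lambda_3)$, $\theta_3=r-\lambda_1-\lambda_2+\lambda_3$, it is semi-regular if exactly one of $\theta_1,\theta_2$ is $0$ and the remaining $\theta$'s are positive. It is STD$(n)$ if its incidence matrix (rows grouped by rows of the array) is partitioned into $n\times n$ submatrices each with constant row sums and constant column sums. A design is $\alpha$-resolvable if its blocks can be partitioned into classes such that each treatment occurs in exactly $\alpha$ blocks of each class; resolvable means $1$-resolvable. -}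

module Defs where

open import Data.Nat using (ℕ; zero; suc; _+_; _*_; _∸_; _%_)
open import Data.Nat.Primality using (Prime)
open import Data.Fin using (Fin; toℕ; remQuot; combine)
open import Data.Fin.Properties using () renaming (_≟_ to _≟ᶠ_)
open import Data.Integer using (ℤ; +_; _-_; +0) renaming (_*_ to _*ℤ_; _+_ to _+ℤ_; _>_ to _>ℤ_)
open import Data.Product using (Σ; ∃; _×_; proj₁; proj₂; _,_)
open import Data.Sum using (_⊎_)
open import Data.Bool using (if_then_else_)
open import Relation.Nullary using (¬_)
open import Relation.Nullary.Decidable using (⌊_⌋)
open import Relation.Binary.PropositionalEquality using (_≡_; _≢_)
import Data.Nat as ℕ

∑ : (n : ℕ) → (Fin n → ℕ) → ℕ
∑ zero    f = 0
∑ (suc n) f = f Fin.zero + ∑ n (λ i → f (Fin.suc i))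
  where import Data.Fin as Fin

Mat : ℕ → Set
Mat n = Fin n → Fin n → ℕ

_⊗_ : ∀ {n} → Mat n → Mat n → Mat n
_⊗_ {n} A B a c = ∑ n (λ e → A a e * B e c)

Id : (n : ℕ) → Mat n
Id n a c = if ⌊ a ≟ᶠ c ⌋ then 1 else 0

_^ᴹ_ : ∀ {n} → Mat n → ℕ → Mat n
_^ᴹ_ {n} A zero    = Id n
_^ᴹ_ {n} A (suc e) = A ⊗ (A ^ᴹ e)

_⊕_ : ∀ {n} → Mat n → Mat n → Mat n
(A ⊕ B) a c = A a c + B a c

Circ : (p : ℕ) → Mat p
Circ zero    ()
Circ (suc q) a c = if ⌊ toℕ c ℕ.≟ (suc (toℕ a)) % (suc q) ⌋ then 1 else 0

-- For a rectangular design the v = m * n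
-- treatments are indexed by Fin (m * n); treatment t sits in row
-- proj₁ (remQuot {m} n t) and column proj₂ (remQuot n t) of the m × n array
-- (i.e. consecutive groups of n rows of the incidence matrix are the
-- rows of the array).

Incidence : ℕ → ℕ → Set
Incidence v b = Fin v → Fin b → ℕ

row : ∀ m n → Fin (m * n) → Fin m
row m n t = proj₁ (remQuot {m} n t)

col : ∀ m n → Fin (m * n) → Fin n
col m n t = proj₂ (remQuot {m} n t)

concurrence : ∀ {v b} → Incidence v b → Fin v → Fin v → ℕ
concurrence {b = b} N t t' = ∑ b (λ x → N t x * N t' x)

record IsRD (m n b r k λ₁ λ₂ λ₃ : ℕ) (N : Incidence (m * n) b) : Set where
  field
    zero-one    : ∀ t x → N t x ≡ 0 ⊎ N t x ≡ 1
    replication : ∀ t → ∑ b (λ x → N t x) ≡ r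
    blocksize   : ∀ x → ∑ (m * n) (λ t → N t x) ≡ k
    sameRow     : ∀ t t' → t ≢ t' → row m n t ≡ row m n t' →
                  concurrence N t t' ≡ λ₁
    sameCol     : ∀ t t' → t ≢ t' → col m n t ≡ col m n t' →
                  concurrence N t t' ≡ λ₂
    other       : ∀ t t' → row m n t ≢ row m n t' → col m n t ≢ col m n t' →
                  concurrence N t t' ≡ λ₃

transpose : ∀ {v b} → Incidence v b → Incidence b v
transpose N x t = N t x

-- Self-dual: the design with the transposed incidence matrix is an RD
-- with the same parameters (blocks arranged in the m × n array in the
-- same way as the treatments: the j-th group of n columns of N is the
-- j-th row of the array).
SelfDual : (m n r k λ₁ λ₂ λ₃ : ℕ) → Incidence (m * n) (m * n) → Set
SelfDual m n r k λ₁ λ₂ λ₃ N = IsRD m n (m * n) k r λ₁ λ₂ λ₃ (transpose N)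

θ₁ θ₂ θ₃ : (m n r λ₁ λ₂ λ₃ : ℕ) → ℤ
θ₁ m n r λ₁ λ₂ λ₃ = (+ r - + λ₁) +ℤ (+ m - + 1) *ℤ (+ λ₂ - + λ₃)
θ₂ m n r λ₁ λ₂ λ₃ = (+ r - + λ₂) +ℤ (+ n - + 1) *ℤ (+ λ₁ - + λ₃)
θ₃ m n r λ₁ λ₂ λ₃ = ((+ r - + λ₁) - + λ₂) +ℤ + λ₃

SemiRegular : (m n r λ₁ λ₂ λ₃ : ℕ) → Set
SemiRegular m n r λ₁ λ₂ λ₃ =
    (θ₁ m n r λ₁ λ₂ λ₃ ≡ +0 × θ₂ m n r λ₁ λ₂ λ₃ >ℤ +0 × θ₃ m n r λ₁ λ₂ λ₃ >ℤ +0)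
  ⊎ (θ₂ m n r λ₁ λ₂ λ₃ ≡ +0 × θ₁ m n r λ₁ λ₂ λ₃ >ℤ +0 × θ₃ m n r λ₁ λ₂ λ₃ >ℤ +0)

STD : (m q n : ℕ) → Incidence (m * n) (q * n) → Set
STD m q n N =
  ∀ (i : Fin m) (j : Fin q) →
    (∃ λ ρ → ∀ (a : Fin n) → ∑ n (λ c → N (combine i a) (combine j c)) ≡ ρ)
  × (∃ λ κ → ∀ (c : Fin n) → ∑ n (λ a → N (combine i a) (combine j c)) ≡ κ)

Resolvable : (α : ℕ) → ∀ {v b} → Incidence v b → Set
Resolvable α {v} {b} N =
  Σ ℕ λ c → Σ (Fin b → Fin c) λ cls →
    ∀ (t : Fin v) (q : Fin c) →
      ∑ b (λ x → if ⌊ cls x ≟ᶠ q ⌋ then N t x else 0) ≡ α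

-- The block matrices of Corollary 11.  Block row i and block column j
-- (0-based in Agda, i.e. i+1, j+1 in the paper, ranging over 1,…,p-1).

blockMatrix : (p : ℕ) → (Fin (p ∸ 1) → Fin (p ∸ 1) → Mat p) →
              Incidence ((p ∸ 1) * p) ((p ∸ 1) * p)
blockMatrix p B t x = B (row (p ∸ 1) p t) (row (p ∸ 1) p x) (col (p ∸ 1) p t) (col (p ∸ 1) p x)

N₁ : (p : ℕ) → Incidence ((p ∸ 1) * p) ((p ∸ 1) * p)
N₁ p = blockMatrix p (λ i j → Circ p ^ᴹ (suc (toℕ i) * suc (toℕ j)))

N₂ : (p : ℕ) → Incidence ((p ∸ 1) * p) ((p ∸ 1) * p)
N₂ p = blockMatrix p (λ i j → Id p ⊕ (Circ p ^ᴹ (suc (toℕ i) * suc (toℕ j))))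

-- Write m = p - 1 and let a treatment (i, a) and a block (j, c) stand for block row/column
-- i, j ∈ {1, …, m} and position a, c ∈ ℤ/p inside the block.  The (a, c) entry of C^e is
-- [c ≡ a + e (mod p)], so N₁ has entries [c ≡ a + ij] and N₂ has entries [c ≡ a] + [c ≡ a + ij].
-- Summing over c, the concurrence of (i, a) and (i', a') becomes a sum over j of terms
-- [a + αj ≡ a' + βj] with α, β ∈ {0, i, i'}: the number of j ∈ {1, …, p - 1} solving
-- (α - β) j ≡ a' - a.  As ℤ/p is a field this number is p - 1, 0, 0 or 1 according as
-- α ≡ β and a ≡ a' hold or fail, which yields every λ; summing over the treatments instead
-- gives the same shape for the dual.  Each block of N₁ is a permutation matrix and each block
-- of N₂ a sum of two, whence the replications, block sizes, STD(p) and the resolution of the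
-- blocks into block columns.

module Submission where

open import Defs
open import Data.Bool using (if_then_else_)
open import Data.Fin as Fin using (Fin; toℕ; fromℕ<; combine; _↑ˡ_; _↑ʳ_)
import Data.Fin.Properties as Fin
import Data.Nat as ℕ
import Data.Nat.Properties as ℕₚ
open import Data.Nat using (ℕ; zero; suc; NonZero)
import Data.Nat.Divisibility as ℕ∣
open import Data.Nat.Primality using (Prime; euclidsLemma; ¬prime[0])
open import Data.Nat.Coprimality using (prime⇒coprime; coprime-Bézout)
open import Data.Nat.GCD using (module Bézout)
import Data.Integer as ℤ
import Data.Integer.Properties as ℤₚ
open import Data.Integer.Properties using (m-n≡m⊖n; ∣m⊝n∣≤m⊔n; ∣i∣≡0⇒i≡0; i-j≡0⇒i≡j; +-injective; +-inverseʳ)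
open import Data.Integer.DivMod using (_%ℕ_; _/ℕ_; n%ℕd<d; a≡a%ℕn+[a/ℕn]*n)
open import Data.Integer.Divisibility.Signed
open import Data.Product using (∃; _×_; _,_; proj₁; proj₂)
open import Data.Sum using (_⊎_; inj₁; inj₂)
import Data.Sum as Sum
open import Function using (_∘_; _⇔_; mk⇔; Equivalence)
open import Relation.Binary.PropositionalEquality
open import Relation.Nullary using (¬_; Dec; map′; yes; no)
open import Relation.Nullary.Decidable using (⌊_⌋; isYes≗does; does-⇔; dec-true; dec-false)
open import Relation.Nullary.Negation using (contradiction)

module FiniteSums where

  open import Data.Nat using (_+_; _*_)
  open import Data.Nat.Properties using (+-assoc; *-zeroʳ; +-identityʳ)
  open import Data.Nat.Tactic.RingSolver using (solve-∀)

  ∑-cong : ∀ {n} {f g : Fin n → ℕ} → (∀ i → f i ≡ g i) → ∑ n f ≡ ∑ n g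
  ∑-cong {zero}  f≗g = refl
  ∑-cong {suc n} f≗g = cong₂ _+_ (f≗g Fin.zero) (∑-cong (λ i → f≗g (Fin.suc i)))

  ∑-distrib-+ : ∀ n (f g : Fin n → ℕ) → ∑ n (λ i → f i + g i) ≡ ∑ n f + ∑ n g
  ∑-distrib-+ zero    f g = refl
  ∑-distrib-+ (suc n) f g = begin
    f₀ + g₀ + ∑ n (λ i → f (Fin.suc i) + g (Fin.suc i))  ≡⟨ cong (f₀ + g₀ +_) (∑-distrib-+ n _ _) ⟩
    f₀ + g₀ + (∑f + ∑g)                                   ≡⟨ interchange f₀ g₀ ∑f ∑g ⟩
    f₀ + ∑f + (g₀ + ∑g)                                   ∎
    where
    open ≡-Reasoning
    f₀ = f Fin.zero
    g₀ = g Fin.zero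
    ∑f = ∑ n (λ i → f (Fin.suc i))
    ∑g = ∑ n (λ i → g (Fin.suc i))
    interchange : ∀ a b c d → a + b + (c + d) ≡ a + c + (b + d)
    interchange = solve-∀

  ∑-const : ∀ n k → ∑ n (λ _ → k) ≡ n * k
  ∑-const zero    k = refl
  ∑-const (suc n) k = cong (k +_) (∑-const n k)

  ∑-zero : ∀ {n} {f : Fin n → ℕ} → (∀ i → f i ≡ 0) → ∑ n f ≡ 0
  ∑-zero {n} f≗0 = trans (∑-cong f≗0) (trans (∑-const n 0) (*-zeroʳ n))

  ∑-single : ∀ {n} (f : Fin n → ℕ) k → (∀ j → j ≢ k → f j ≡ 0) → ∑ n f ≡ f k
  ∑-single f Fin.zero others =
    trans (cong (f Fin.zero +_) (∑-zero (λ i → others (Fin.suc i) λ ())))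
          (+-identityʳ (f Fin.zero))
  ∑-single f (Fin.suc k) others =
    trans (cong (_+ ∑ _ (λ i → f (Fin.suc i))) (others Fin.zero λ ()))
          (∑-single (λ i → f (Fin.suc i)) k (λ j j≢k → others (Fin.suc j) (j≢k ∘ Fin.suc-injective)))

  ∑-++ : ∀ m n (f : Fin (m + n) → ℕ) → ∑ (m + n) f ≡ ∑ m (λ i → f (i ↑ˡ n)) + ∑ n (λ j → f (m ↑ʳ j))
  ∑-++ zero    n f = refl
  ∑-++ (suc m) n f = trans (cong (f Fin.zero +_) (∑-++ m n (λ i → f (Fin.suc i)))) (sym (+-assoc (f Fin.zero) _ _))

  ∑-combine : ∀ m n (f : Fin (m * n) → ℕ) → ∑ (m * n) f ≡ ∑ m (λ i → ∑ n (λ a → f (combine i a)))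
  ∑-combine zero    n f = refl
  ∑-combine (suc m) n f = trans (∑-++ n (m * n) f) (cong (∑ n (λ a → f (a ↑ˡ m * n)) +_) (∑-combine m n (λ t → f (n ↑ʳ t))))

open FiniteSums

indicator-⇔ : ∀ {A B : Set} → A ⇔ B → (a? : Dec A) (b? : Dec B) →
              (if ⌊ a? ⌋ then 1 else 0) ≡ (if ⌊ b? ⌋ then 1 else 0)
indicator-⇔ A⇔B a? b? =
  cong (if_then 1 else 0) (trans (isYes≗does a?) (trans (does-⇔ A⇔B a? b?) (sym (isYes≗does b?))))

module Congruence where

  open import Data.Integer using (ℤ; +_; _+_; _-_; -_; 0ℤ)
  open import Data.Integer.Tactic.RingSolver using (solve-∀)

  infix 4 _≡_mod_
  record _≡_mod_ (x y : ℤ) (n : ℕ) : Set where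
    constructor mod-∣
    field ∣-diff : + n ∣ x - y
  open _≡_mod_ public

  _≡?_mod_ : ∀ x y n → Dec (x ≡ y mod n)
  x ≡? y mod n = map′ mod-∣ ∣-diff (+ n ∣? x - y)

  variable
    n : ℕ
    x y z x' y' : ℤ

  ≡-mod-reflexive : x ≡ y → x ≡ y mod n
  ≡-mod-reflexive {x} refl = mod-∣ (divides 0ℤ (+-inverseʳ x))

  ≡-mod-refl : x ≡ x mod n
  ≡-mod-refl = ≡-mod-reflexive refl

  ≡-mod-sym : x ≡ y mod n → y ≡ x mod n
  ≡-mod-sym {x = x} {y = y} (mod-∣ n∣x-y) = mod-∣ (subst (_ ∣_) (neg-diff x y) (∣m⇒∣-m n∣x-y))
    where
    neg-diff : ∀ x y → - (x - y) ≡ y - x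
    neg-diff = solve-∀

  ≡-mod-trans : x ≡ y mod n → y ≡ z mod n → x ≡ z mod n
  ≡-mod-trans {x = x} {y = y} {z = z} (mod-∣ n∣x-y) (mod-∣ n∣y-z) =
    mod-∣ (subst (_ ∣_) (telescope x y z) (∣m∣n⇒∣m+n n∣x-y n∣y-z))
    where
    telescope : ∀ x y z → (x - y) + (y - z) ≡ x - z
    telescope = solve-∀

  ≡-mod-diff : x - y ≡ x' - y' → x ≡ y mod n → x' ≡ y' mod n
  ≡-mod-diff eq (mod-∣ n∣x-y) = mod-∣ (subst (_ ∣_) eq n∣x-y)

  ≡0-mod⇔∣ : x ≡ 0ℤ mod n ⇔ + n ∣ x
  ≡0-mod⇔∣ {x} = mk⇔ (λ h → subst (_ ∣_) (ℤₚ.+-identityʳ x) (∣-diff h))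
                     (λ h → mod-∣ (subst (_ ∣_) (sym (ℤₚ.+-identityʳ x)) h))

open Congruence

module Modular (n : ℕ) .{{_ : NonZero n}} where

  open import Data.Integer using (ℤ; +_; _+_; _-_; -_; _*_)
  open import Data.Integer.Tactic.RingSolver using (solve-∀)

  opaque
    δ : ℤ → ℤ → ℕ
    δ x y = if ⌊ x ≡? y mod n ⌋ then 1 else 0

    indicator≡δ : ∀ {A : Set} {x y} (a? : Dec A) → A ⇔ x ≡ y mod n → (if ⌊ a? ⌋ then 1 else 0) ≡ δ x y
    indicator≡δ {x = x} {y} a? A⇔ = indicator-⇔ A⇔ a? (x ≡? y mod n)

    δ-yes : ∀ {x y} → x ≡ y mod n → δ x y ≡ 1
    δ-yes {x} {y} x≡y = cong (if_then 1 else 0) (trans (isYes≗does (x ≡? y mod n)) (dec-true (x ≡? y mod n) x≡y))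

    δ-no : ∀ {x y} → ¬ x ≡ y mod n → δ x y ≡ 0
    δ-no {x} {y} x≢y = cong (if_then 1 else 0) (trans (isYes≗does (x ≡? y mod n)) (dec-false (x ≡? y mod n) x≢y))

    δ≡1⇒≡ : ∀ {x y} → δ x y ≡ 1 → x ≡ y mod n
    δ≡1⇒≡ {x} {y} with x ≡? y mod n
    ... | yes x≡y = λ _ → x≡y
    ... | no  _   = λ ()

  δ-zero-one : ∀ x y → δ x y ≡ 0 ⊎ δ x y ≡ 1
  δ-zero-one x y with x ≡? y mod n
  ... | yes x≡y = inj₂ (δ-yes x≡y)
  ... | no  x≢y = inj₁ (δ-no x≢y)

  δ-⇔ : ∀ {x y x' y'} → x ≡ y mod n ⇔ x' ≡ y' mod n → δ x y ≡ δ x' y'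
  δ-⇔ {x} {y} equiv with x ≡? y mod n
  ... | yes x≡y = trans (δ-yes x≡y) (sym (δ-yes (Equivalence.to equiv x≡y)))
  ... | no  x≢y = trans (δ-no x≢y) (sym (δ-no (x≢y ∘ Equivalence.from equiv)))

  δ-cong : ∀ {x y x' y'} → x ≡ x' mod n → y ≡ y' mod n → δ x y ≡ δ x' y'
  δ-cong x≡x' y≡y' = δ-⇔ (mk⇔
    (λ x≡y → ≡-mod-trans (≡-mod-sym x≡x') (≡-mod-trans x≡y y≡y'))
    (λ x'≡y' → ≡-mod-trans x≡x' (≡-mod-trans x'≡y' (≡-mod-sym y≡y'))))

  δ-diff : ∀ {x y x' y'} → x - y ≡ x' - y' → δ x y ≡ δ x' y'
  δ-diff eq = δ-⇔ (mk⇔ (≡-mod-diff eq) (≡-mod-diff (sym eq)))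

  δ-sym : ∀ x y → δ x y ≡ δ y x
  δ-sym x y = δ-⇔ (mk⇔ ≡-mod-sym ≡-mod-sym)

  δ+δ-zero-one : ∀ x {y y'} → ¬ y ≡ y' mod n → δ x y ℕ.+ δ x y' ≡ 0 ⊎ δ x y ℕ.+ δ x y' ≡ 1
  δ+δ-zero-one x {y} {y'} y≢y' with δ-zero-one x y | δ-zero-one x y'
  ... | inj₁ δ≡0 | inj₁ δ'≡0 = inj₁ (cong₂ ℕ._+_ δ≡0 δ'≡0)
  ... | inj₁ δ≡0 | inj₂ δ'≡1 = inj₂ (cong₂ ℕ._+_ δ≡0 δ'≡1)
  ... | inj₂ δ≡1 | inj₁ δ'≡0 = inj₂ (cong₂ ℕ._+_ δ≡1 δ'≡0)
  ... | inj₂ δ≡1 | inj₂ δ'≡1 = contradiction (≡-mod-trans (≡-mod-sym (δ≡1⇒≡ δ≡1)) (δ≡1⇒≡ δ'≡1)) y≢y'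

  residue : ℤ → Fin n
  residue z = fromℕ< (n%ℕd<d z n)

  residue-≡ : ∀ z → + toℕ (residue z) ≡ z mod n
  residue-≡ z = mod-∣ (divides (- (z /ℕ n)) (begin
    + toℕ (residue z) - z                        ≡⟨ cong (λ r → + r - z) (Fin.toℕ-fromℕ< (n%ℕd<d z n)) ⟩
    + (z %ℕ n) - z                                ≡⟨ cong (λ w → + (z %ℕ n) - w) (a≡a%ℕn+[a/ℕn]*n z n) ⟩
    + (z %ℕ n) - (+ (z %ℕ n) + (z /ℕ n) * + n)    ≡⟨ cancel (+ (z %ℕ n)) (z /ℕ n) (+ n) ⟩
    - (z /ℕ n) * + n                              ∎))
    where
    open ≡-Reasoning
    cancel : ∀ r q k → r - (r + q * k) ≡ - q * k
    cancel = solve-∀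

  toℕ-injective-mod : ∀ {a b : Fin n} → + toℕ a ≡ + toℕ b mod n → a ≡ b
  toℕ-injective-mod {a} {b} (mod-∣ n∣a-b) =
    Fin.toℕ-injective (+-injective (i-j≡0⇒i≡j _ _ (∣i∣≡0⇒i≡0 (below-n⇒0 ∣a-b∣<n (∣⇒∣ᵤ n∣a-b)))))
    where
    below-n⇒0 : ∀ {k} → k ℕ.< n → n ℕ∣.∣ k → k ≡ 0
    below-n⇒0 {zero}  _   _   = refl
    below-n⇒0 {suc k} k<n n∣k = contradiction n∣k (ℕ∣.>⇒∤ k<n)
    ∣a-b∣<n : ℤ.∣ + toℕ a - + toℕ b ∣ ℕ.< n
    ∣a-b∣<n = subst (ℕ._< n) (cong ℤ.∣_∣ (sym (m-n≡m⊖n (toℕ a) (toℕ b))))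
      (ℕₚ.≤-<-trans (∣m⊝n∣≤m⊔n (toℕ a) (toℕ b)) (ℕₚ.⊔-lub (Fin.toℕ<n a) (Fin.toℕ<n b)))

  ∑-sift : ∀ u (f : Fin n → ℕ) → ∑ n (λ c → δ (+ toℕ c) u ℕ.* f c) ≡ f (residue u)
  ∑-sift u f = trans (∑-single _ (residue u) off-residue) (trans (cong (ℕ._* f (residue u)) on-residue) (ℕₚ.*-identityˡ _))
    where
    on-residue : δ (+ toℕ (residue u)) u ≡ 1
    on-residue = δ-yes (residue-≡ u)
    off-residue : ∀ c → c ≢ residue u → δ (+ toℕ c) u ℕ.* f c ≡ 0
    off-residue c c≢r = cong (ℕ._* f c) (δ-no λ c≡u → c≢r (toℕ-injective-mod (≡-mod-trans c≡u (≡-mod-sym (residue-≡ u)))))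

  ∑-δ-δ : ∀ u v → ∑ n (λ c → δ (+ toℕ c) u ℕ.* δ (+ toℕ c) v) ≡ δ u v
  ∑-δ-δ u v = trans (∑-sift u (λ c → δ (+ toℕ c) v)) (δ-cong (residue-≡ u) ≡-mod-refl)

module Circulant (m : ℕ) where

  open import Data.Integer using (ℤ; +_; _+_; _-_; 1ℤ)
  open import Data.Integer.Tactic.RingSolver using (solve-∀)
  open Modular (suc m)

  Id-δ : ∀ a c → Id (suc m) a c ≡ δ (+ toℕ c) (+ toℕ a)
  Id-δ a c = indicator≡δ (a Fin.≟ c) (mk⇔ (λ { refl → ≡-mod-refl }) (sym ∘ toℕ-injective-mod))

  Circ-δ : ∀ a c → Circ (suc m) a c ≡ δ (+ toℕ c) (1ℤ + + toℕ a)
  Circ-δ a c = indicator≡δ (toℕ c ℕ.≟ suc (toℕ a) ℕ.% suc m) (mk⇔ to from)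
    where
    r = residue (+ suc (toℕ a))
    toℕ-r : toℕ r ≡ suc (toℕ a) ℕ.% suc m
    toℕ-r = Fin.toℕ-fromℕ< _
    to : toℕ c ≡ suc (toℕ a) ℕ.% suc m → + toℕ c ≡ + suc (toℕ a) mod suc m
    to c≡ = subst (λ k → + k ≡ _ mod suc m) (trans toℕ-r (sym c≡)) (residue-≡ _)
    from : + toℕ c ≡ + suc (toℕ a) mod suc m → toℕ c ≡ suc (toℕ a) ℕ.% suc m
    from c≡ = trans (cong toℕ (toℕ-injective-mod (≡-mod-trans c≡ (≡-mod-sym (residue-≡ _))))) toℕ-r

  Circ^-δ : ∀ e a c → (Circ (suc m) ^ᴹ e) a c ≡ δ (+ toℕ c) (+ toℕ a + + e)
  Circ^-δ zero a c = trans (Id-δ a c) (δ-cong ≡-mod-refl (≡-mod-reflexive (sym (ℤₚ.+-identityʳ (+ toℕ a)))))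
  Circ^-δ (suc e) a c = begin
    ∑ (suc m) (λ d → Circ (suc m) a d ℕ.* (Circ (suc m) ^ᴹ e) d c)
      ≡⟨ ∑-cong (λ d → cong₂ ℕ._*_ (Circ-δ a d) (Circ^-δ e d c)) ⟩
    ∑ (suc m) (λ d → δ (+ toℕ d) a⁺ ℕ.* δ (+ toℕ c) (+ toℕ d + + e))
      ≡⟨ ∑-sift a⁺ (λ d → δ (+ toℕ c) (+ toℕ d + + e)) ⟩
    δ (+ toℕ c) (+ toℕ (residue a⁺) + + e)
      ≡⟨ δ-cong ≡-mod-refl (≡-mod-diff (cancel (+ toℕ (residue a⁺)) a⁺ (+ e)) (residue-≡ a⁺)) ⟩
    δ (+ toℕ c) (a⁺ + + e)
      ≡⟨ cong (δ (+ toℕ c)) (shift (+ toℕ a) (+ e)) ⟩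
    δ (+ toℕ c) (+ toℕ a + (1ℤ + + e))
      ∎
    where
    open ≡-Reasoning
    a⁺ : ℤ
    a⁺ = 1ℤ + + toℕ a
    cancel : ∀ x y z → x - y ≡ (x + z) - (y + z)
    cancel = solve-∀
    shift : ∀ x y → (1ℤ + x) + y ≡ x + (1ℤ + y)
    shift = solve-∀

  Circ^-rowSum : ∀ e a → ∑ (suc m) (λ c → (Circ (suc m) ^ᴹ e) a c) ≡ 1
  Circ^-rowSum e a = begin
    ∑ (suc m) (λ c → (Circ (suc m) ^ᴹ e) a c)         ≡⟨ ∑-cong (λ c → trans (Circ^-δ e a c) (sym (ℕₚ.*-identityʳ _))) ⟩
    ∑ (suc m) (λ c → δ (+ toℕ c) (+ toℕ a + + e) ℕ.* 1) ≡⟨ ∑-sift (+ toℕ a + + e) (λ _ → 1) ⟩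
    1                                                   ∎
    where open ≡-Reasoning

  Circ^-colSum : ∀ e c → ∑ (suc m) (λ a → (Circ (suc m) ^ᴹ e) a c) ≡ 1
  Circ^-colSum e c = begin
    ∑ (suc m) (λ a → (Circ (suc m) ^ᴹ e) a c)          ≡⟨ ∑-cong (λ a → trans (Circ^-δ e a c) (move a)) ⟩
    ∑ (suc m) (λ a → δ (+ toℕ a) (+ toℕ c - + e) ℕ.* 1) ≡⟨ ∑-sift (+ toℕ c - + e) (λ _ → 1) ⟩
    1                                                   ∎
    where
    open ≡-Reasoning
    flip : ∀ c a e → c - (a + e) ≡ (c - e) - a
    flip = solve-∀
    move : ∀ a → δ (+ toℕ c) (+ toℕ a + + e) ≡ δ (+ toℕ a) (+ toℕ c - + e) ℕ.* 1
    move a = trans (δ-diff (flip (+ toℕ c) (+ toℕ a) (+ e))) (trans (δ-sym (+ toℕ c - + e) (+ toℕ a)) (sym (ℕₚ.*-identityʳ _)))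

module BlockIncidence where

  open import Data.Nat using (_+_; _*_; _∸_)
  open import Data.Nat.Tactic.RingSolver renaming (solve-∀ to ℕ-solve-∀)

  row-combine : ∀ {m n} (i : Fin m) (a : Fin n) → row m n (combine i a) ≡ i
  row-combine i a = cong proj₁ (Fin.remQuot-combine i a)

  col-combine : ∀ {m n} (i : Fin m) (a : Fin n) → col m n (combine i a) ≡ a
  col-combine i a = cong proj₂ (Fin.remQuot-combine i a)

  row-col-injective : ∀ {m n} {t t' : Fin (m * n)} → row m n t ≡ row m n t' → col m n t ≡ col m n t' → t ≡ t'
  row-col-injective {m} {n} {t} {t'} r≡ c≡ =
    trans (sym (Fin.combine-remQuot {m} n t)) (trans (cong₂ combine r≡ c≡) (Fin.combine-remQuot {m} n t'))

  blockMatrix-combineʳ : ∀ p B t j c →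
    blockMatrix p B t (combine j c) ≡ B (row (p ∸ 1) p t) j (col (p ∸ 1) p t) c
  blockMatrix-combineʳ p B t j c =
    cong₂ (λ j' c' → B (row (p ∸ 1) p t) j' (col (p ∸ 1) p t) c') (row-combine j c) (col-combine j c)

  blockMatrix-combineˡ : ∀ p B i a x →
    blockMatrix p B (combine i a) x ≡ B i (row (p ∸ 1) p x) a (col (p ∸ 1) p x)
  blockMatrix-combineˡ p B i a x =
    cong₂ (λ i' a' → B i' (row (p ∸ 1) p x) a' (col (p ∸ 1) p x)) (row-combine i a) (col-combine i a)

  ∑-constant-blocks : ∀ q n {ρ} (f : Fin (q * n) → ℕ) → (∀ j → ∑ n (λ c → f (combine j c)) ≡ ρ) → ∑ (q * n) f ≡ q * ρ
  ∑-constant-blocks q n {ρ} f block-sum = trans (∑-combine q n f) (trans (∑-cong {q} block-sum) (∑-const q ρ))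

  resolvable-by-blockColumns : ∀ {v q n} ρ (N : Incidence v (q * n)) →
    (∀ t j → ∑ n (λ c → N t (combine j c)) ≡ ρ) → Resolvable ρ N
  resolvable-by-blockColumns {q = q} {n} ρ N block-sum = q , row q n , λ t k → begin
    ∑ (q * n) (λ x → if ⌊ row q n x Fin.≟ k ⌋ then N t x else 0)
      ≡⟨ ∑-combine q n _ ⟩
    ∑ q (λ j → ∑ n (λ c → if ⌊ row q n (combine j c) Fin.≟ k ⌋ then N t (combine j c) else 0))
      ≡⟨ ∑-cong {q} (λ j → ∑-cong {n} (λ c → cong (λ r → if ⌊ r Fin.≟ k ⌋ then N t (combine j c) else 0) (row-combine j c))) ⟩
    ∑ q (λ j → ∑ n (λ c → if ⌊ j Fin.≟ k ⌋ then N t (combine j c) else 0))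
      ≡⟨ ∑-single _ k (class-sum-off t k) ⟩
    ∑ n (λ c → if ⌊ k Fin.≟ k ⌋ then N t (combine k c) else 0)
      ≡⟨ class-sum-on t k ⟩
    ρ ∎
    where
    open ≡-Reasoning
    class-sum-off : ∀ t k j → j ≢ k → ∑ n (λ c → if ⌊ j Fin.≟ k ⌋ then N t (combine j c) else 0) ≡ 0
    class-sum-off t k j j≢k with j Fin.≟ k
    ... | yes j≡k = contradiction j≡k j≢k
    ... | no  _   = ∑-zero {n} (λ _ → refl)
    class-sum-on : ∀ t k → ∑ n (λ c → if ⌊ k Fin.≟ k ⌋ then N t (combine k c) else 0) ≡ ρ
    class-sum-on t k with k Fin.≟ k
    ... | yes _   = block-sum t k
    ... | no  k≢k = contradiction refl k≢k

  crossConcurrence : ∀ {v b} → Incidence v b → Incidence v b → Fin v → Fin v → ℕ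
  crossConcurrence {b = b} N M t t' = ∑ b (λ x → N t x * M t' x)

  concurrence-⊕ : ∀ {v} (N M : Mat v) t t' →
    concurrence (N ⊕ M) t t' ≡
      crossConcurrence N N t t' + crossConcurrence N M t t' + crossConcurrence M N t t' + crossConcurrence M M t t'
  concurrence-⊕ {v} N M t t' = begin
    ∑ v (λ x → (N t x + M t x) * (N t' x + M t' x))
      ≡⟨ ∑-cong {v} (λ x → expand (N t x) (M t x) (N t' x) (M t' x)) ⟩
    ∑ v (λ x → N t x * N t' x + N t x * M t' x + (M t x * N t' x + M t x * M t' x))
      ≡⟨ ∑-distrib-+ v _ _ ⟩
    ∑ v (λ x → N t x * N t' x + N t x * M t' x) + ∑ v (λ x → M t x * N t' x + M t x * M t' x)
      ≡⟨ cong₂ _+_ (∑-distrib-+ v _ _) (∑-distrib-+ v _ _) ⟩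
    (NN + NM) + (MN + MM)
      ≡⟨ sym (ℕₚ.+-assoc (NN + NM) MN MM) ⟩
    NN + NM + MN + MM ∎
    where
    open ≡-Reasoning
    NN = crossConcurrence N N t t'
    NM = crossConcurrence N M t t'
    MN = crossConcurrence M N t t'
    MM = crossConcurrence M M t t'
    expand : ∀ a b c d → (a + b) * (c + d) ≡ a * c + a * d + (b * c + b * d)
    expand = ℕ-solve-∀

module LinearCongruences (m : ℕ) where

  open import Data.Integer using (ℤ; +_; _+_; _-_; -_; _*_; 1ℤ)
  open import Data.Integer.Tactic.RingSolver using (solve-∀)
  open Modular (suc m)

  -- The paper's 1-based block index j + 1, a nonzero residue modulo suc m.
  label : Fin m → ℤ
  label j = + toℕ (Fin.suc j)

  label-injective : ∀ {j j'} → label j ≡ label j' mod suc m → j ≡ j'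
  label-injective = Fin.suc-injective ∘ toℕ-injective-mod

  label-nonzero : ∀ j → ¬ + suc m ∣ label j
  label-nonzero j p∣j with toℕ-injective-mod {a = Fin.suc j} {b = Fin.zero} (Equivalence.from ≡0-mod⇔∣ p∣j)
  ... | ()

  nonzero-is-label : ∀ {z} → ¬ + suc m ∣ z → ∃ λ j → label j ≡ z mod suc m
  nonzero-is-label {z} p∤z with residue z | residue-≡ z
  ... | Fin.zero  | 0≡z = contradiction (Equivalence.to ≡0-mod⇔∣ (≡-mod-sym 0≡z)) p∤z
  ... | Fin.suc j | j≡z = j , j≡z

  opaque
    solutions : ℤ → ℤ → ℤ → ℤ → ℕ
    solutions x α y β = ∑ m (λ j → δ (x + α * label j) (y + β * label j))

    solutions-unfold : ∀ x α y β → solutions x α y β ≡ ∑ m (λ j → δ (x + α * label j) (y + β * label j))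
    solutions-unfold x α y β = refl

  module _ (p-prime : Prime (suc m)) where

    ∣-euclid : ∀ x y → + suc m ∣ x * y → + suc m ∣ x ⊎ + suc m ∣ y
    ∣-euclid x y p∣xy = Sum.map ∣ᵤ⇒∣ ∣ᵤ⇒∣
      (euclidsLemma ℤ.∣ x ∣ ℤ.∣ y ∣ p-prime (subst (suc m ℕ∣.∣_) (ℤₚ.abs-* x y) (∣⇒∣ᵤ p∣xy)))

    inverse : ∀ {s} → ¬ + suc m ∣ s → ∃ λ u → + suc m ∣ u * s - 1ℤ
    inverse {s} p∤s = from-Bézout (coprime-Bézout (prime⇒coprime p-prime {{r≢0}} (Fin.toℕ<n (residue s))))
      where
      r = toℕ (residue s)
      p∣s-r : + suc m ∣ s - + r
      p∣s-r = ∣-diff (≡-mod-sym (residue-≡ s))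
      r≢0 : NonZero r
      r≢0 = ℕ.≢-nonZero λ r≡0 → p∤s (Equivalence.to ≡0-mod⇔∣ (subst (λ k → s ≡ + k mod suc m) r≡0 (≡-mod-sym (residue-≡ s))))
      toℤ : ∀ a b c d → 1 ℕ.+ a ℕ.* b ≡ c ℕ.* d → 1ℤ + + a * + b ≡ + c * + d
      toℤ a b c d eq = trans (cong (λ w → 1ℤ + w) (sym (ℤₚ.pos-* a b))) (trans (cong +_ eq) (ℤₚ.pos-* c d))
      combination : ∀ u X → u * s - 1ℤ ≡ u * (s - + r) - X * + suc m → + suc m ∣ u * s - 1ℤ
      combination u X eq = subst (_ ∣_) (sym eq) (∣m∣n⇒∣m-n (∣n⇒∣m*n u p∣s-r) (∣n⇒∣m*n X ∣-refl))
      from-Bézout : Bézout.Identity 1 (suc m) r → ∃ λ u → + suc m ∣ u * s - 1ℤ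
      from-Bézout (Bézout.+- x y eq) = - + y , combination (- + y) (+ x) (begin
        (- + y) * s - 1ℤ                           ≡⟨ regroup (+ y) s (+ r) ⟩
        (- + y) * (s - + r) - (1ℤ + + y * + r)     ≡⟨ cong (λ w → (- + y) * (s - + r) - w) (toℤ y r x (suc m) eq) ⟩
        (- + y) * (s - + r) - + x * + suc m        ∎)
        where
        open ≡-Reasoning
        regroup : ∀ Y S R → (- Y) * S - 1ℤ ≡ (- Y) * (S - R) - (1ℤ + Y * R)
        regroup = solve-∀
      from-Bézout (Bézout.-+ x y eq) = + y , combination (+ y) (- + x) (begin
        + y * s - 1ℤ                               ≡⟨ regroup (+ y) s (+ r) ⟩
        + y * (s - + r) - (1ℤ - + y * + r)         ≡⟨ cong (λ w → + y * (s - + r) - (1ℤ - w)) (sym (toℤ x (suc m) y r eq)) ⟩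
        + y * (s - + r) - (1ℤ - (1ℤ + + x * + suc m)) ≡⟨ cancel (+ y * (s - + r)) (+ x) (+ suc m) ⟩
        + y * (s - + r) - (- + x) * + suc m        ∎)
        where
        open ≡-Reasoning
        regroup : ∀ Y S R → Y * S - 1ℤ ≡ Y * (S - R) - (1ℤ - Y * R)
        regroup = solve-∀
        cancel : ∀ A X P → A - (1ℤ - (1ℤ + X * P)) ≡ A - (- X) * P
        cancel = solve-∀

    private
      p∤-from : ∀ {α β} → ¬ α ≡ β mod suc m → ¬ + suc m ∣ α - β
      p∤-from α≢β = α≢β ∘ mod-∣
      p∣-flip : ∀ {x y} → x ≡ y mod suc m → + suc m ∣ y - x
      p∣-flip = ∣-diff ∘ ≡-mod-sym
      p∤-flip : ∀ {x y} → ¬ x ≡ y mod suc m → ¬ + suc m ∣ y - x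
      p∤-flip x≢y = x≢y ∘ ≡-mod-sym ∘ mod-∣

    solutions-as-count : ∀ x α y β → solutions x α y β ≡ ∑ m (λ j → δ ((α - β) * label j) (y - x))
    solutions-as-count x α y β = trans (solutions-unfold x α y β) (∑-cong {m} (λ j → δ-diff (regroup x α y β (label j))))
      where
      regroup : ∀ x α y β L → (x + α * L) - (y + β * L) ≡ (α - β) * L - (y - x)
      regroup = solve-∀

    solutions-≡-≡ : ∀ {x α y β} → α ≡ β mod suc m → x ≡ y mod suc m → solutions x α y β ≡ m
    solutions-≡-≡ {x} {α} {y} {β} α≡β x≡y = begin
      solutions x α y β                              ≡⟨ solutions-as-count x α y β ⟩
      ∑ m (λ j → δ ((α - β) * label j) (y - x))      ≡⟨ ∑-cong {m} (λ j → δ-yes (mod-∣ (every j))) ⟩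
      ∑ m (λ _ → 1)                                  ≡⟨ ∑-const m 1 ⟩
      m ℕ.* 1                                        ≡⟨ ℕₚ.*-identityʳ m ⟩
      m                                              ∎
      where
      open ≡-Reasoning
      every : ∀ j → + suc m ∣ (α - β) * label j - (y - x)
      every j = ∣m∣n⇒∣m-n (∣m⇒∣m*n (label j) (∣-diff α≡β)) (p∣-flip x≡y)

    solutions-≡-≢ : ∀ {x α y β} → α ≡ β mod suc m → ¬ x ≡ y mod suc m → solutions x α y β ≡ 0
    solutions-≡-≢ {x} {α} {y} {β} α≡β x≢y =
      trans (solutions-as-count x α y β) (∑-zero {m} (λ j → δ-no (none j ∘ ∣-diff)))
      where
      none : ∀ j → ¬ + suc m ∣ (α - β) * label j - (y - x)
      none j p∣ = p∤-flip x≢y (subst (_ ∣_) (cancel ((α - β) * label j) (y - x))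
        (∣m∣n⇒∣m-n (∣m⇒∣m*n (label j) (∣-diff α≡β)) p∣))
        where
        cancel : ∀ A D → A - (A - D) ≡ D
        cancel = solve-∀

    solutions-≢-≡ : ∀ {x α y β} → ¬ α ≡ β mod suc m → x ≡ y mod suc m → solutions x α y β ≡ 0
    solutions-≢-≡ {x} {α} {y} {β} α≢β x≡y =
      trans (solutions-as-count x α y β) (∑-zero {m} (λ j → δ-no (none j ∘ ∣-diff)))
      where
      none : ∀ j → ¬ + suc m ∣ (α - β) * label j - (y - x)
      none j p∣ with ∣-euclid (α - β) (label j)
                       (subst (_ ∣_) (cancel ((α - β) * label j) (y - x)) (∣m∣n⇒∣m+n p∣ (p∣-flip x≡y)))
        where
        cancel : ∀ A D → (A - D) + D ≡ A
        cancel = solve-∀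
      ... | inj₁ p∣α-β = p∤-from α≢β p∣α-β
      ... | inj₂ p∣j   = label-nonzero j p∣j

    solution-unique : ∀ {s d j j'} → ¬ + suc m ∣ s →
      + suc m ∣ s * label j - d → + suc m ∣ s * label j' - d → j ≡ j'
    solution-unique {s} {d} {j} {j'} p∤s p∣j p∣j'
      with ∣-euclid s (label j - label j') (subst (_ ∣_) (difference s (label j) (label j') d) (∣m∣n⇒∣m-n p∣j p∣j'))
      where
      difference : ∀ s L L' d → (s * L - d) - (s * L' - d) ≡ s * (L - L')
      difference = solve-∀
    ... | inj₁ p∣s = contradiction p∣s p∤s
    ... | inj₂ p∣Δ = label-injective (mod-∣ p∣Δ)

    solution-from-inverse : ∀ {s d} u → + suc m ∣ u * s - 1ℤ → ¬ + suc m ∣ d → ∃ λ j → + suc m ∣ s * label j - d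
    solution-from-inverse {s} {d} u p∣us-1 p∤d with nonzero-is-label p∤ud
      where
      recover : ∀ s u d → s * (u * d) - d * (u * s - 1ℤ) ≡ d
      recover = solve-∀
      p∤ud : ¬ + suc m ∣ u * d
      p∤ud p∣ud = p∤d (subst (_ ∣_) (recover s u d) (∣m∣n⇒∣m-n (∣n⇒∣m*n s p∣ud) (∣n⇒∣m*n d p∣us-1)))
    ... | j , j≡ud = j , subst (_ ∣_) (split s (label j) u d) (∣m∣n⇒∣m+n (∣n⇒∣m*n s (∣-diff j≡ud)) (∣n⇒∣m*n d p∣us-1))
      where
      split : ∀ s L u d → s * (L - u * d) + d * (u * s - 1ℤ) ≡ s * L - d
      split = solve-∀

    solution-exists : ∀ {s d} → ¬ + suc m ∣ s → ¬ + suc m ∣ d → ∃ λ j → + suc m ∣ s * label j - d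
    solution-exists p∤s p∤d with inverse p∤s
    ... | u , p∣us-1 = solution-from-inverse u p∣us-1 p∤d

    count-unique-solution : ∀ {s d} j₀ → ¬ + suc m ∣ s → + suc m ∣ s * label j₀ - d → ∑ m (λ j → δ (s * label j) d) ≡ 1
    count-unique-solution {s} {d} j₀ p∤s solves =
      trans (∑-single (λ j → δ (s * label j) d) j₀ off) (δ-yes (mod-∣ solves))
      where
      off : ∀ j → j ≢ j₀ → δ (s * label j) d ≡ 0
      off j j≢j₀ = δ-no (λ j-solves → j≢j₀ (solution-unique p∤s (∣-diff j-solves) solves))

    solutions-≢-≢ : ∀ {x α y β} → ¬ α ≡ β mod suc m → ¬ x ≡ y mod suc m → solutions x α y β ≡ 1
    solutions-≢-≢ {x} {α} {y} {β} α≢β x≢y =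
      trans (solutions-as-count x α y β) (count-unique-solution {α - β} {y - x} (proj₁ E) (p∤-from α≢β) (proj₂ E))
      where
      E : ∃ λ j → + suc m ∣ (α - β) * label j - (y - x)
      E = solution-exists (p∤-from α≢β) (p∤-flip x≢y)

module BlockCirculant (m : ℕ) where

  open import Data.Integer using (ℤ; +_; _+_; _-_; _*_)
  open import Data.Integer.Tactic.RingSolver using (solve-∀)
  open Modular (suc m)
  open Circulant m
  open BlockIncidence
  open LinearCongruences m

  blocks : (Fin m → Fin m → ℕ) → Fin m → Fin m → Mat (suc m)
  blocks e i j = Circ (suc m) ^ᴹ e i j

  circulantBlocks : (Fin m → Fin m → ℕ) → Incidence (m ℕ.* suc m) (m ℕ.* suc m)
  circulantBlocks e = blockMatrix (suc m) (blocks e)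

  rowOf : Fin (m ℕ.* suc m) → Fin m
  rowOf = row m (suc m)

  colℤ : Fin (m ℕ.* suc m) → ℤ
  colℤ t = + toℕ (col m (suc m) t)

  circulantBlocks-rowSum : ∀ e t j → ∑ (suc m) (λ c → circulantBlocks e t (combine j c)) ≡ 1
  circulantBlocks-rowSum e t j =
    trans (∑-cong {suc m} (blockMatrix-combineʳ (suc m) (blocks e) t j))
          (Circ^-rowSum (e (rowOf t) j) (col m (suc m) t))

  circulantBlocks-colSum : ∀ e i x → ∑ (suc m) (λ a → circulantBlocks e (combine i a) x) ≡ 1
  circulantBlocks-colSum e i x =
    trans (∑-cong {suc m} (λ a → blockMatrix-combineˡ (suc m) (blocks e) i a x))
          (Circ^-colSum (e i (rowOf x)) (col m (suc m) x))

  circulantBlocks-entry : ∀ e t x → circulantBlocks e t x ≡ δ (colℤ x) (colℤ t + + e (rowOf t) (rowOf x))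
  circulantBlocks-entry e t x = Circ^-δ (e (rowOf t) (rowOf x)) (col m (suc m) t) (col m (suc m) x)

  circulantBlocks-entryʳ : ∀ e t j c → circulantBlocks e t (combine j c) ≡ δ (+ toℕ c) (colℤ t + + e (rowOf t) j)
  circulantBlocks-entryʳ e t j c =
    trans (blockMatrix-combineʳ (suc m) (blocks e) t j c) (Circ^-δ (e (rowOf t) j) (col m (suc m) t) c)

  circulantBlocks-entryˡ : ∀ e i a x → circulantBlocks e (combine i a) x ≡ δ (+ toℕ a) (colℤ x - + e i (rowOf x))
  circulantBlocks-entryˡ e i a x = begin
    circulantBlocks e (combine i a) x
      ≡⟨ trans (blockMatrix-combineˡ (suc m) (blocks e) i a x) (Circ^-δ (e i (rowOf x)) a (col m (suc m) x)) ⟩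
    δ (colℤ x) (+ toℕ a + + e i (rowOf x))         ≡⟨ δ-diff (flip (colℤ x) (+ toℕ a) (+ e i (rowOf x))) ⟩
    δ (colℤ x - + e i (rowOf x)) (+ toℕ a)         ≡⟨ δ-sym (colℤ x - + e i (rowOf x)) (+ toℕ a) ⟩
    δ (+ toℕ a) (colℤ x - + e i (rowOf x))         ∎
    where
    open ≡-Reasoning
    flip : ∀ c a e → c - (a + e) ≡ (c - e) - a
    flip = solve-∀

  crossConcurrence-circulantBlocks : ∀ {e e' : Fin m → Fin m → ℕ} (κ κ' : Fin m → ℤ) →
    (∀ i j → + e i j ≡ κ i * label j) → (∀ i j → + e' i j ≡ κ' i * label j) → ∀ t t' →
    crossConcurrence (circulantBlocks e) (circulantBlocks e') t t' ≡
      solutions (colℤ t) (κ (rowOf t)) (colℤ t') (κ' (rowOf t'))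
  crossConcurrence-circulantBlocks {e} {e'} κ κ' e≡κ e'≡κ' t t' = begin
    crossConcurrence (circulantBlocks e) (circulantBlocks e') t t'
      ≡⟨ ∑-combine m (suc m) (λ x → circulantBlocks e t x ℕ.* circulantBlocks e' t' x) ⟩
    ∑ m (λ j → ∑ (suc m) (λ c → circulantBlocks e t (combine j c) ℕ.* circulantBlocks e' t' (combine j c)))
      ≡⟨ ∑-cong {m} (λ j → ∑-cong {suc m} (λ c →
           cong₂ ℕ._*_ (circulantBlocks-entryʳ e t j c) (circulantBlocks-entryʳ e' t' j c))) ⟩
    ∑ m (λ j → ∑ (suc m) (λ c → δ (+ toℕ c) (colℤ t + + e (rowOf t) j) ℕ.* δ (+ toℕ c) (colℤ t' + + e' (rowOf t') j)))
      ≡⟨ ∑-cong {m} (λ j → ∑-δ-δ (colℤ t + + e (rowOf t) j) (colℤ t' + + e' (rowOf t') j)) ⟩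
    ∑ m (λ j → δ (colℤ t + + e (rowOf t) j) (colℤ t' + + e' (rowOf t') j))
      ≡⟨ ∑-cong {m} (λ j → cong₂ (λ u v → δ (colℤ t + u) (colℤ t' + v)) (e≡κ (rowOf t) j) (e'≡κ' (rowOf t') j)) ⟩
    ∑ m (λ j → δ (colℤ t + κ (rowOf t) * label j) (colℤ t' + κ' (rowOf t') * label j))
      ≡⟨ sym (solutions-unfold (colℤ t) (κ (rowOf t)) (colℤ t') (κ' (rowOf t'))) ⟩
    solutions (colℤ t) (κ (rowOf t)) (colℤ t') (κ' (rowOf t')) ∎
    where open ≡-Reasoning

  crossConcurrence-transpose-circulantBlocks : ∀ {e e' : Fin m → Fin m → ℕ} (μ μ' : Fin m → ℤ) →
    (∀ i j → + e i j ≡ μ j * label i) → (∀ i j → + e' i j ≡ μ' j * label i) → ∀ x x' →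
    crossConcurrence (transpose (circulantBlocks e)) (transpose (circulantBlocks e')) x x' ≡
      solutions (colℤ x) (μ' (rowOf x')) (colℤ x') (μ (rowOf x))
  crossConcurrence-transpose-circulantBlocks {e} {e'} μ μ' e≡μ e'≡μ' x x' = begin
    crossConcurrence (transpose (circulantBlocks e)) (transpose (circulantBlocks e')) x x'
      ≡⟨ ∑-combine m (suc m) (λ t → circulantBlocks e t x ℕ.* circulantBlocks e' t x') ⟩
    ∑ m (λ i → ∑ (suc m) (λ a → circulantBlocks e (combine i a) x ℕ.* circulantBlocks e' (combine i a) x'))
      ≡⟨ ∑-cong {m} (λ i → ∑-cong {suc m} (λ a →
           cong₂ ℕ._*_ (circulantBlocks-entryˡ e i a x) (circulantBlocks-entryˡ e' i a x'))) ⟩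
    ∑ m (λ i → ∑ (suc m) (λ a → δ (+ toℕ a) (colℤ x - + e i (rowOf x)) ℕ.* δ (+ toℕ a) (colℤ x' - + e' i (rowOf x'))))
      ≡⟨ ∑-cong {m} (λ i → ∑-δ-δ (colℤ x - + e i (rowOf x)) (colℤ x' - + e' i (rowOf x'))) ⟩
    ∑ m (λ i → δ (colℤ x - + e i (rowOf x)) (colℤ x' - + e' i (rowOf x')))
      ≡⟨ ∑-cong {m} (λ i → δ-diff (swap (colℤ x) (+ e i (rowOf x)) (colℤ x') (+ e' i (rowOf x')))) ⟩
    ∑ m (λ i → δ (colℤ x + + e' i (rowOf x')) (colℤ x' + + e i (rowOf x)))
      ≡⟨ ∑-cong {m} (λ i → cong₂ (λ u v → δ (colℤ x + u) (colℤ x' + v)) (e'≡μ' i (rowOf x')) (e≡μ i (rowOf x))) ⟩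
    ∑ m (λ i → δ (colℤ x + μ' (rowOf x') * label i) (colℤ x' + μ (rowOf x) * label i))
      ≡⟨ sym (solutions-unfold (colℤ x) (μ' (rowOf x')) (colℤ x') (μ (rowOf x))) ⟩
    solutions (colℤ x) (μ' (rowOf x')) (colℤ x') (μ (rowOf x)) ∎
    where
    open ≡-Reasoning
    swap : ∀ c u c' u' → (c - u) - (c' - u') ≡ (c + u') - (c' + u)
    swap = solve-∀

module CirculantDesigns (m : ℕ) (p-prime : Prime (suc m)) where

  open import Data.Integer using (ℤ; +_; _+_; _-_; _*_; 0ℤ)
  open import Data.Integer.Tactic.RingSolver using (solve-∀)
  open import Data.Nat.Tactic.RingSolver renaming (solve-∀ to ℕ-solve-∀)
  open Modular (suc m)
  open BlockIncidence
  open LinearCongruences m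
  open BlockCirculant m

  E : Fin m → Fin m → ℕ
  E i j = suc (toℕ i) ℕ.* suc (toℕ j)

  private
    label-≡ : ∀ {i i'} → i ≡ i' → label i ≡ label i' mod suc m
    label-≡ refl = ≡-mod-refl

    label-≢ : ∀ {i i'} → i ≢ i' → ¬ label i ≡ label i' mod suc m
    label-≢ i≢i' = i≢i' ∘ label-injective

    label-≢0 : ∀ i → ¬ label i ≡ 0ℤ mod suc m
    label-≢0 i = label-nonzero i ∘ Equivalence.to ≡0-mod⇔∣

    0≢label : ∀ i → ¬ 0ℤ ≡ label i mod suc m
    0≢label i = label-≢0 i ∘ ≡-mod-sym

    colℤ-≡ : ∀ {t t'} → col m (suc m) t ≡ col m (suc m) t' → colℤ t ≡ colℤ t' mod suc m
    colℤ-≡ c≡c' = ≡-mod-reflexive (cong (λ a → + toℕ a) c≡c')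

    colℤ-≢ : ∀ {t t'} → col m (suc m) t ≢ col m (suc m) t' → ¬ colℤ t ≡ colℤ t' mod suc m
    colℤ-≢ c≢c' = c≢c' ∘ toℕ-injective-mod

    cols-differ : ∀ {t t'} → t ≢ t' → rowOf t ≡ rowOf t' → col m (suc m) t ≢ col m (suc m) t'
    cols-differ t≢t' r≡r' c≡c' = t≢t' (row-col-injective r≡r' c≡c')

    rows-differ : ∀ {t t'} → t ≢ t' → col m (suc m) t ≡ col m (suc m) t' → rowOf t ≢ rowOf t'
    rows-differ t≢t' c≡c' r≡r' = t≢t' (row-col-injective r≡r' c≡c')

  concurrence-N₁ : ∀ t t' →
    concurrence (N₁ (suc m)) t t' ≡ solutions (colℤ t) (label (rowOf t)) (colℤ t') (label (rowOf t'))
  concurrence-N₁ = crossConcurrence-circulantBlocks label label (λ _ _ → refl) (λ _ _ → refl)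

  concurrence-transpose-N₁ : ∀ x x' →
    concurrence (transpose (N₁ (suc m))) x x' ≡ solutions (colℤ x) (label (rowOf x')) (colℤ x') (label (rowOf x))
  concurrence-transpose-N₁ = crossConcurrence-transpose-circulantBlocks label label E-comm E-comm
    where
    E-comm : ∀ i j → + E i j ≡ label j * label i
    E-comm i j = ℤₚ.*-comm (label i) (label j)

  N₁-blockRowSum : ∀ t j → ∑ (suc m) (λ c → N₁ (suc m) t (combine j c)) ≡ 1
  N₁-blockRowSum = circulantBlocks-rowSum E

  N₁-blockColSum : ∀ i x → ∑ (suc m) (λ a → N₁ (suc m) (combine i a) x) ≡ 1
  N₁-blockColSum = circulantBlocks-colSum E

  N₁-replication : ∀ t → ∑ (m ℕ.* suc m) (λ x → N₁ (suc m) t x) ≡ m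
  N₁-replication t = trans (∑-constant-blocks m (suc m) (N₁ (suc m) t) (N₁-blockRowSum t)) (ℕₚ.*-identityʳ m)

  N₁-blockSize : ∀ x → ∑ (m ℕ.* suc m) (λ t → N₁ (suc m) t x) ≡ m
  N₁-blockSize x = trans (∑-constant-blocks m (suc m) (λ t → N₁ (suc m) t x) (λ i → N₁-blockColSum i x)) (ℕₚ.*-identityʳ m)

  N₁-zero-one : ∀ t x → N₁ (suc m) t x ≡ 0 ⊎ N₁ (suc m) t x ≡ 1
  N₁-zero-one t x = subst (λ k → k ≡ 0 ⊎ k ≡ 1) (sym (circulantBlocks-entry E t x))
    (δ-zero-one (colℤ x) (colℤ t + + E (rowOf t) (rowOf x)))

  N₁-isRD : IsRD m (suc m) (m ℕ.* suc m) m m 0 0 1 (N₁ (suc m))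
  N₁-isRD = record
    { zero-one    = N₁-zero-one
    ; replication = N₁-replication
    ; blocksize   = N₁-blockSize
    ; sameRow     = λ t t' t≢t' r≡r' → trans (concurrence-N₁ t t')
                      (solutions-≡-≢ p-prime (label-≡ r≡r') (colℤ-≢ (cols-differ t≢t' r≡r')))
    ; sameCol     = λ t t' t≢t' c≡c' → trans (concurrence-N₁ t t')
                      (solutions-≢-≡ p-prime (label-≢ (rows-differ t≢t' c≡c')) (colℤ-≡ c≡c'))
    ; other       = λ t t' r≢r' c≢c' → trans (concurrence-N₁ t t')
                      (solutions-≢-≢ p-prime (label-≢ r≢r') (colℤ-≢ c≢c'))
    }

  N₁-selfDual : SelfDual m (suc m) m m 0 0 1 (N₁ (suc m))
  N₁-selfDual = record
    { zero-one    = λ x t → N₁-zero-one t x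
    ; replication = N₁-blockSize
    ; blocksize   = N₁-replication
    ; sameRow     = λ x x' x≢x' r≡r' → trans (concurrence-transpose-N₁ x x')
                      (solutions-≡-≢ p-prime (label-≡ (sym r≡r')) (colℤ-≢ (cols-differ x≢x' r≡r')))
    ; sameCol     = λ x x' x≢x' c≡c' → trans (concurrence-transpose-N₁ x x')
                      (solutions-≢-≡ p-prime (label-≢ (rows-differ x≢x' c≡c' ∘ sym)) (colℤ-≡ c≡c'))
    ; other       = λ x x' r≢r' c≢c' → trans (concurrence-transpose-N₁ x x')
                      (solutions-≢-≢ p-prime (label-≢ (r≢r' ∘ sym)) (colℤ-≢ c≢c'))
    }

  N₁-STD : STD m m (suc m) (N₁ (suc m))
  N₁-STD i j = (1 , λ a → N₁-blockRowSum (combine i a) j) , (1 , λ c → N₁-blockColSum i (combine j c))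

  N₁-resolvable : Resolvable 1 (N₁ (suc m))
  N₁-resolvable = resolvable-by-blockColumns 1 (N₁ (suc m)) N₁-blockRowSum

  -- Id = C⁰, so N₂ (suc m) is definitionally Z ⊕ P.
  private
    Z P : Incidence (m ℕ.* suc m) (m ℕ.* suc m)
    Z = circulantBlocks (λ _ _ → 0)
    P = circulantBlocks E

    zero-linear : ∀ (i j : Fin m) → + 0 ≡ 0ℤ * label j
    zero-linear _ _ = refl

    E-linear : ∀ i j → + E i j ≡ label i * label j
    E-linear _ _ = refl

    E-linearᵀ : ∀ i j → + E i j ≡ label j * label i
    E-linearᵀ i j = ℤₚ.*-comm (label i) (label j)

    sum-of-four : ∀ {a b c d a' b' c' d'} → a ≡ a' → b ≡ b' → c ≡ c' → d ≡ d' →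
                  a ℕ.+ b ℕ.+ c ℕ.+ d ≡ a' ℕ.+ b' ℕ.+ c' ℕ.+ d'
    sum-of-four refl refl refl refl = refl

    m+0+0+0≡m : ∀ m → m ℕ.+ 0 ℕ.+ 0 ℕ.+ 0 ≡ m
    m+0+0+0≡m = ℕ-solve-∀

  concurrence-N₂ : ∀ t t' → concurrence (N₂ (suc m)) t t' ≡
      solutions (colℤ t) 0ℤ (colℤ t') 0ℤ ℕ.+ solutions (colℤ t) 0ℤ (colℤ t') (label (rowOf t'))
    ℕ.+ solutions (colℤ t) (label (rowOf t)) (colℤ t') 0ℤ ℕ.+ solutions (colℤ t) (label (rowOf t)) (colℤ t') (label (rowOf t'))
  concurrence-N₂ t t' = trans (concurrence-⊕ Z P t t') (sum-of-four
    (crossConcurrence-circulantBlocks (λ _ → 0ℤ) (λ _ → 0ℤ) zero-linear zero-linear t t')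
    (crossConcurrence-circulantBlocks (λ _ → 0ℤ) label zero-linear E-linear t t')
    (crossConcurrence-circulantBlocks label (λ _ → 0ℤ) E-linear zero-linear t t')
    (crossConcurrence-circulantBlocks label label E-linear E-linear t t'))

  concurrence-transpose-N₂ : ∀ x x' → concurrence (transpose (N₂ (suc m))) x x' ≡
      solutions (colℤ x) 0ℤ (colℤ x') 0ℤ ℕ.+ solutions (colℤ x) (label (rowOf x')) (colℤ x') 0ℤ
    ℕ.+ solutions (colℤ x) 0ℤ (colℤ x') (label (rowOf x)) ℕ.+ solutions (colℤ x) (label (rowOf x')) (colℤ x') (label (rowOf x))
  concurrence-transpose-N₂ x x' = trans (concurrence-⊕ (transpose Z) (transpose P) x x') (sum-of-four
    (crossConcurrence-transpose-circulantBlocks (λ _ → 0ℤ) (λ _ → 0ℤ) zero-linear zero-linear x x')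
    (crossConcurrence-transpose-circulantBlocks (λ _ → 0ℤ) label zero-linear E-linearᵀ x x')
    (crossConcurrence-transpose-circulantBlocks label (λ _ → 0ℤ) E-linearᵀ zero-linear x x')
    (crossConcurrence-transpose-circulantBlocks label label E-linearᵀ E-linearᵀ x x'))

  N₂-blockRowSum : ∀ t j → ∑ (suc m) (λ c → N₂ (suc m) t (combine j c)) ≡ 2
  N₂-blockRowSum t j = trans (∑-distrib-+ (suc m) (λ c → Z t (combine j c)) (λ c → P t (combine j c)))
    (cong₂ ℕ._+_ (circulantBlocks-rowSum (λ _ _ → 0) t j) (circulantBlocks-rowSum E t j))

  N₂-blockColSum : ∀ i x → ∑ (suc m) (λ a → N₂ (suc m) (combine i a) x) ≡ 2
  N₂-blockColSum i x = trans (∑-distrib-+ (suc m) (λ a → Z (combine i a) x) (λ a → P (combine i a) x))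
    (cong₂ ℕ._+_ (circulantBlocks-colSum (λ _ _ → 0) i x) (circulantBlocks-colSum E i x))

  N₂-replication : ∀ t → ∑ (m ℕ.* suc m) (λ x → N₂ (suc m) t x) ≡ 2 ℕ.* m
  N₂-replication t = trans (∑-constant-blocks m (suc m) (N₂ (suc m) t) (N₂-blockRowSum t)) (ℕₚ.*-comm m 2)

  N₂-blockSize : ∀ x → ∑ (m ℕ.* suc m) (λ t → N₂ (suc m) t x) ≡ 2 ℕ.* m
  N₂-blockSize x = trans (∑-constant-blocks m (suc m) (λ t → N₂ (suc m) t x) (λ i → N₂-blockColSum i x)) (ℕₚ.*-comm m 2)

  N₂-zero-one : ∀ t x → N₂ (suc m) t x ≡ 0 ⊎ N₂ (suc m) t x ≡ 1
  N₂-zero-one t x = subst (λ k → k ≡ 0 ⊎ k ≡ 1)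
    (sym (cong₂ ℕ._+_ (circulantBlocks-entry (λ _ _ → 0) t x) (circulantBlocks-entry E t x)))
    (δ+δ-zero-one (colℤ x) shifts-differ)
    where
    L = label (rowOf t) * label (rowOf x)
    shift : ∀ a L → (a + 0ℤ) - (a + L) ≡ 0ℤ - L
    shift = solve-∀
    shifts-differ : ¬ colℤ t + 0ℤ ≡ colℤ t + L mod suc m
    shifts-differ same = Sum.[ label-nonzero (rowOf t) , label-nonzero (rowOf x) ]
      (∣-euclid p-prime (label (rowOf t)) (label (rowOf x))
        (Equivalence.to ≡0-mod⇔∣ (≡-mod-sym (≡-mod-diff (shift (colℤ t) L) same))))

  N₂-isRD : IsRD m (suc m) (m ℕ.* suc m) (2 ℕ.* m) (2 ℕ.* m) 2 m 3 (N₂ (suc m))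
  N₂-isRD = record
    { zero-one    = N₂-zero-one
    ; replication = N₂-replication
    ; blocksize   = N₂-blockSize
    ; sameRow     = λ t t' t≢t' r≡r' → let c≢c' = colℤ-≢ (cols-differ t≢t' r≡r') in
        trans (concurrence-N₂ t t') (sum-of-four
          (solutions-≡-≢ p-prime ≡-mod-refl c≢c')
          (solutions-≢-≢ p-prime (0≢label (rowOf t')) c≢c')
          (solutions-≢-≢ p-prime (label-≢0 (rowOf t)) c≢c')
          (solutions-≡-≢ p-prime (label-≡ r≡r') c≢c'))
    ; sameCol     = λ t t' t≢t' c≡c' → let c≡ = colℤ-≡ c≡c' in
        trans (concurrence-N₂ t t') (trans (sum-of-four
          (solutions-≡-≡ p-prime ≡-mod-refl c≡)
          (solutions-≢-≡ p-prime (0≢label (rowOf t')) c≡)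
          (solutions-≢-≡ p-prime (label-≢0 (rowOf t)) c≡)
          (solutions-≢-≡ p-prime (label-≢ (rows-differ t≢t' c≡c')) c≡)) (m+0+0+0≡m m))
    ; other       = λ t t' r≢r' c≢c' → let c≢ = colℤ-≢ c≢c' in
        trans (concurrence-N₂ t t') (sum-of-four
          (solutions-≡-≢ p-prime ≡-mod-refl c≢)
          (solutions-≢-≢ p-prime (0≢label (rowOf t')) c≢)
          (solutions-≢-≢ p-prime (label-≢0 (rowOf t)) c≢)
          (solutions-≢-≢ p-prime (label-≢ r≢r') c≢))
    }

  N₂-selfDual : SelfDual m (suc m) (2 ℕ.* m) (2 ℕ.* m) 2 m 3 (N₂ (suc m))
  N₂-selfDual = record
    { zero-one    = λ x t → N₂-zero-one t x
    ; replication = N₂-blockSize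
    ; blocksize   = N₂-replication
    ; sameRow     = λ x x' x≢x' r≡r' → let c≢c' = colℤ-≢ (cols-differ x≢x' r≡r') in
        trans (concurrence-transpose-N₂ x x') (sum-of-four
          (solutions-≡-≢ p-prime ≡-mod-refl c≢c')
          (solutions-≢-≢ p-prime (label-≢0 (rowOf x')) c≢c')
          (solutions-≢-≢ p-prime (0≢label (rowOf x)) c≢c')
          (solutions-≡-≢ p-prime (label-≡ (sym r≡r')) c≢c'))
    ; sameCol     = λ x x' x≢x' c≡c' → let c≡ = colℤ-≡ c≡c' in
        trans (concurrence-transpose-N₂ x x') (trans (sum-of-four
          (solutions-≡-≡ p-prime ≡-mod-refl c≡)
          (solutions-≢-≡ p-prime (label-≢0 (rowOf x')) c≡)
          (solutions-≢-≡ p-prime (0≢label (rowOf x)) c≡)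
          (solutions-≢-≡ p-prime (label-≢ (rows-differ x≢x' c≡c' ∘ sym)) c≡)) (m+0+0+0≡m m))
    ; other       = λ x x' r≢r' c≢c' → let c≢ = colℤ-≢ c≢c' in
        trans (concurrence-transpose-N₂ x x') (sum-of-four
          (solutions-≡-≢ p-prime ≡-mod-refl c≢)
          (solutions-≢-≢ p-prime (label-≢0 (rowOf x')) c≢)
          (solutions-≢-≢ p-prime (0≢label (rowOf x)) c≢)
          (solutions-≢-≢ p-prime (label-≢ (r≢r' ∘ sym)) c≢))
    }

  N₂-STD : STD m m (suc m) (N₂ (suc m))
  N₂-STD i j = (2 , λ a → N₂-blockRowSum (combine i a) j) , (2 , λ c → N₂-blockColSum i (combine j c))

  N₂-resolvable : Resolvable 2 (N₂ (suc m))
  N₂-resolvable = resolvable-by-blockColumns 2 (N₂ (suc m)) N₂-blockRowSum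

module SemiRegularity where

  open import Data.Integer using (ℤ; +_; _+_; _-_; _*_; 0ℤ; 1ℤ; _>_; +<+)
  open import Data.Integer.Tactic.RingSolver using (solve-∀)
  open import Data.Nat using (z≤n; s≤s)

  semiRegular₁ : ∀ m → SemiRegular m (suc m) m 0 0 1
  semiRegular₁ m = inj₂ (θ₂≡0 (+ m) , subst (_> 0ℤ) (sym (θ₁≡1 (+ m))) (+<+ (s≤s z≤n))
                                     , subst (_> 0ℤ) (sym (θ₃≡1+m (+ m))) (+<+ (s≤s z≤n)))
    where
    θ₁≡1 : ∀ M → (M - 0ℤ) + (M - 1ℤ) * (0ℤ - 1ℤ) ≡ 1ℤ
    θ₁≡1 = solve-∀
    θ₂≡0 : ∀ M → (M - 0ℤ) + ((1ℤ + M) - 1ℤ) * (0ℤ - 1ℤ) ≡ 0ℤ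
    θ₂≡0 = solve-∀
    θ₃≡1+m : ∀ M → ((M - 0ℤ) - 0ℤ) + 1ℤ ≡ 1ℤ + M
    θ₃≡1+m = solve-∀

  -- For p = 2 the value θ₁ = (m - 1)² vanishes, so (ii) is semi-regular only when p > 2.
  semiRegular₂ : ∀ m → 2 ℕ.< suc m → SemiRegular m (suc m) (2 ℕ.* m) 2 m 3
  semiRegular₂ (suc (suc k)) _ =
    inj₂ (θ₂≡0 (+ suc k) , subst (_> 0ℤ) (sym (θ₁≡[m-1]² (+ suc k))) (+<+ (s≤s z≤n))
                          , subst (_> 0ℤ) (sym (θ₃≡1+m (+ suc k))) (+<+ (s≤s z≤n)))
    where
    θ₁≡[m-1]² : ∀ Q → (((1ℤ + Q) + ((1ℤ + Q) + 0ℤ)) - (1ℤ + 1ℤ)) + ((1ℤ + Q) - 1ℤ) * ((1ℤ + Q) - (1ℤ + (1ℤ + 1ℤ))) ≡ Q * Q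
    θ₁≡[m-1]² = solve-∀
    θ₂≡0 : ∀ Q → (((1ℤ + Q) + ((1ℤ + Q) + 0ℤ)) - (1ℤ + Q)) + ((1ℤ + (1ℤ + Q)) - 1ℤ) * ((1ℤ + 1ℤ) - (1ℤ + (1ℤ + 1ℤ))) ≡ 0ℤ
    θ₂≡0 = solve-∀
    θ₃≡1+m : ∀ Q → ((((1ℤ + Q) + ((1ℤ + Q) + 0ℤ)) - (1ℤ + 1ℤ)) - (1ℤ + Q)) + (1ℤ + (1ℤ + 1ℤ)) ≡ 1ℤ + (1ℤ + Q)
    θ₃≡1+m = solve-∀
  semiRegular₂ zero          (s≤s ())
  semiRegular₂ (suc zero)    (s≤s (s≤s ()))

open SemiRegularity
open import Data.Nat using (_∸_; _*_; _<_)

corollary11 : (p : ℕ) → Prime p →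
    ( IsRD (p ∸ 1) p ((p ∸ 1) * p) (p ∸ 1) (p ∸ 1) 0 0 1 (N₁ p)
    × STD (p ∸ 1) (p ∸ 1) p (N₁ p)
    × Resolvable 1 (N₁ p)
    × SemiRegular (p ∸ 1) p (p ∸ 1) 0 0 1
    × SelfDual (p ∸ 1) p (p ∸ 1) (p ∸ 1) 0 0 1 (N₁ p) )
    ×
    ( IsRD (p ∸ 1) p ((p ∸ 1) * p) (2 * (p ∸ 1)) (2 * (p ∸ 1)) 2 (p ∸ 1) 3 (N₂ p)
    × STD (p ∸ 1) (p ∸ 1) p (N₂ p)
    × Resolvable 2 (N₂ p)
    × (2 < p → SemiRegular (p ∸ 1) p (2 * (p ∸ 1)) 2 (p ∸ 1) 3)
    × SelfDual (p ∸ 1) p (2 * (p ∸ 1)) (2 * (p ∸ 1)) 2 (p ∸ 1) 3 (N₂ p) )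
corollary11 zero    p-prime = contradiction p-prime ¬prime[0]
corollary11 (suc m) p-prime =
    (N₁-isRD , N₁-STD , N₁-resolvable , semiRegular₁ m , N₁-selfDual)
  , (N₂-isRD , N₂-STD , N₂-resolvable , semiRegular₂ m , N₂-selfDual)
  where open CirculantDesigns m p-prime
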